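{- Let $p$ be a prime, $m$ an integer, and $k \geq 0$, $r \geq 1$ integers. Then \[ \binom{m p^r - 1}{k} (-1)^k \equiv \binom{m p^{r-1} - 1}{\lfloor k/p \rfloor} (-1)^{\lfloor k/p \rfloor} \pmod{p^r}. \]
   Context: For an integer $a$ (possibly negative) and an integer $b \geq 0$, $\binom{a}{b} = \prod_{j=1}^{b} \frac{a - j + 1}{j}$ (an integer). $\lfloor x \rfloor$ denotes the largest integer not exceeding $x$. -}

module Defs where

open import Data.Nat as ℕ using (ℕ; zero; suc; _!)
open import Data.Nat.Properties using (_!≢0)
open import Data.Integer as ℤ using (ℤ; +_; _-_; _*_)
open import Data.Integer.DivMod using (_/ℕ_)

falling : ℤ → ℕ → ℤ
falling a zero    = + 1
falling a (suc b) = falling a b * (a - + b)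

-- generalized binomial coefficient  (a choose b) = ∏_{j=1}^{b} (a-j+1)/j
-- computed as falling a b / b!  (the division is exact)
binomℤ : ℤ → ℕ → ℤ
binomℤ a b = _/ℕ_ (falling a b) (b !) {{b !≢0}}

sgn : ℕ → ℤ
sgn zero    = + 1
sgn (suc k) = ℤ.- sgn k

module Submission where

-- Put S(a,k) = (-1)^k binom(a-1,k) = ∏_{j=1}^{k} (j-a)/j,
-- so that S(a,k+1)·(k+1) = S(a,k)·(k+1-a).  For N = M·p split the product
-- defining S(N,k) according to whether p divides j: a factor with j = i·p is
-- (ip - Mp)/(ip) = (i-M)/i, and these factors together form S(M,⌊k/p⌋).
-- With D(k) = ∏_{j≤k, p∤j} j and E(N,k) = ∏_{j≤k, p∤j} (j-N) this is the
-- exact factorisation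
--     D(k) · S(Mp, k) = E(Mp, k) · S(M, ⌊k/p⌋).
-- If p^r ∣ N then E(N,k) ≡ D(k) (mod p^r), hence p^r ∣ D(k)·(S(N,k) - S(M,⌊k/p⌋)),
-- and as p ∤ D(k) the factor D(k) cancels.  Taking M = m p^(r-1) gives lemma2p4.

open import Defs
open import Data.Nat as ℕ using (ℕ; zero; suc; _!; _^_; _/_; _%_; _∸_; _≤_)
open import Data.Nat.Properties as ℕP using (_!≢0)
import Data.Nat.DivMod as ℕD
open import Data.Nat.Divisibility as ℕ∣ using () renaming (_∣_ to _∣ₙ_; _∤_ to _∤ₙ_; _∣?_ to _∣ₙ?_)
open import Data.Nat.Primality using (Prime; prime⇒nonZero; prime⇒nonTrivial; euclidsLemma)
open import Data.Integer as ℤ using (ℤ; +_; -[1+_]; _-_; _*_; _+_; 1ℤ; 0ℤ)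
import Data.Integer.Properties as ℤP
open import Data.Integer.DivMod using (_/ℕ_)
open import Data.Integer.Divisibility using (_∣_)
open import Data.Integer.Divisibility.Signed as ℤ∣ using (divides) renaming (_∣_ to _∣ₛ_)
open import Data.Integer.Tactic.RingSolver using (solve-∀)
open import Relation.Binary.PropositionalEquality
open import Relation.Nullary using (yes; no)
open import Data.Empty using (⊥-elim)
open import Data.Sum using (inj₁; inj₂)

falling-suc-top : ∀ a k → falling (a + 1ℤ) (suc k) ≡ (a + 1ℤ) * falling a k
falling-suc-top a zero = base a
  where base : ∀ a → 1ℤ * (a + 1ℤ - 0ℤ) ≡ (a + 1ℤ) * 1ℤ
        base = solve-∀
falling-suc-top a (suc k) = begin
  falling (a + 1ℤ) (suc k) * (a + 1ℤ - + suc k)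
    ≡⟨ cong₂ _*_ (falling-suc-top a k) (cong (λ z → a + 1ℤ - z) (ℤP.pos-+ 1 k)) ⟩
  (a + 1ℤ) * falling a k * (a + 1ℤ - (1ℤ + + k))
    ≡⟨ regroup a (falling a k) (+ k) ⟩
  (a + 1ℤ) * (falling a k * (a - + k)) ∎
  where open ≡-Reasoning
        regroup : ∀ a F k → (a + 1ℤ) * F * (a + 1ℤ - (1ℤ + k)) ≡ (a + 1ℤ) * (F * (a - k))
        regroup = solve-∀

falling-pascal : ∀ a k → falling (a + 1ℤ) (suc k) ≡ falling a (suc k) + + suc k * falling a k
falling-pascal a k = begin
  falling (a + 1ℤ) (suc k)                          ≡⟨ falling-suc-top a k ⟩
  (a + 1ℤ) * falling a k                            ≡⟨ split a (falling a k) (+ k) ⟩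
  falling a k * (a - + k) + (1ℤ + + k) * falling a k ≡⟨ cong (λ z → falling a (suc k) + z * falling a k) (sym (ℤP.pos-+ 1 k)) ⟩
  falling a k * (a - + k) + + suc k * falling a k   ∎
  where open ≡-Reasoning
        split : ∀ a F k → (a + 1ℤ) * F ≡ F * (a - k) + (1ℤ + k) * F
        split = solve-∀

falling-zero : ∀ k → falling 0ℤ (suc k) ≡ 0ℤ
falling-zero k = falling-suc-top -[1+ 0 ] k

-- Integrality of binomial coefficients: k! divides a(a-1)…(a-k+1) for every
-- integer a.  Induction on k, and for fixed k+1 on a in both directions from
-- a = 0, using Pascal's rule.
factorial-∣-falling : ∀ k a → + (k !) ∣ₛ falling a k
factorial-∣-falling zero a = divides (falling a zero) refl
factorial-∣-falling (suc k) = onℤ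
  where
  pascal-term : ∀ a → + (suc k !) ∣ₛ + suc k * falling a k
  pascal-term a = subst (_∣ₛ + suc k * falling a k) (sym (ℤP.pos-* (suc k) (k !)))
                        (ℤ∣.*-monoʳ-∣ (+ suc k) (factorial-∣-falling k a))
  upward : ∀ n → + (suc k !) ∣ₛ falling (+ n) (suc k)
  upward zero    = subst (+ (suc k !) ∣ₛ_) (sym (falling-zero k)) (divides 0ℤ refl)
  upward (suc n) = subst (λ z → + (suc k !) ∣ₛ falling (+ z) (suc k)) (ℕP.+-comm n 1)
                         (subst (+ (suc k !) ∣ₛ_) (sym (falling-pascal (+ n) k))
                                (ℤ∣.∣m∣n⇒∣m+n (upward n) (pascal-term (+ n))))
  downward : ∀ n → + (suc k !) ∣ₛ falling -[1+ n ] (suc k)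
  downward n = ℤ∣.∣m+n∣n⇒∣m (subst (+ (suc k !) ∣ₛ_) (falling-pascal -[1+ n ] k) (successor n))
                            (pascal-term -[1+ n ])
    where successor : ∀ n → + (suc k !) ∣ₛ falling (-[1+ n ] + 1ℤ) (suc k)
          successor zero    = upward 0
          successor (suc n) = downward n
  onℤ : ∀ a → + (suc k !) ∣ₛ falling a (suc k)
  onℤ (+ n)    = upward n
  onℤ -[1+ n ] = downward n

/ℕ-exact : ∀ n d .{{_ : ℕ.NonZero d}} → d ∣ₙ ℤ.∣ n ∣ → (n /ℕ d) * + d ≡ n
/ℕ-exact (+ x) d d∣x = trans (sym (ℤP.pos-* (x / d) d)) (cong +_ (ℕD.m/n*n≡m d∣x))
/ℕ-exact -[1+ x ] d d∣x with suc x % d in rem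
... | zero  = trans (sym (ℤP.neg-distribˡ-* (+ (suc x / d)) (+ d)))
                    (cong ℤ.-_ (trans (sym (ℤP.pos-* (suc x / d) d)) (cong +_ (ℕD.m/n*n≡m d∣x))))
... | suc _ with () ← trans (sym rem) (ℕ∣.n∣m⇒m%n≡0 (suc x) d d∣x)

binomℤ-spec : ∀ a k → binomℤ a k * + (k !) ≡ falling a k
binomℤ-spec a k = /ℕ-exact (falling a k) (k !) {{k !≢0}} (ℤ∣.∣⇒∣ᵤ (factorial-∣-falling k a))

binomℤ-suc : ∀ a k → binomℤ a (suc k) * + suc k ≡ binomℤ a k * (a - + k)
binomℤ-suc a k = ℤP.*-cancelʳ-≡ _ _ (+ (k !)) {{k!≢0}} (begin
  binomℤ a (suc k) * + suc k * + (k !)   ≡⟨ ℤP.*-assoc (binomℤ a (suc k)) (+ suc k) (+ (k !)) ⟩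
  binomℤ a (suc k) * (+ suc k * + (k !)) ≡⟨ cong (binomℤ a (suc k) *_) (sym (ℤP.pos-* (suc k) (k !))) ⟩
  binomℤ a (suc k) * + (suc k !)         ≡⟨ binomℤ-spec a (suc k) ⟩
  falling a k * (a - + k)                ≡⟨ cong (_* (a - + k)) (sym (binomℤ-spec a k)) ⟩
  binomℤ a k * + (k !) * (a - + k)       ≡⟨ swap (binomℤ a k) (+ (k !)) (a - + k) ⟩
  binomℤ a k * (a - + k) * + (k !)       ∎)
  where open ≡-Reasoning
        k!≢0 : ℤ.NonZero (+ (k !))
        k!≢0 = record { nonZero = ℕ.NonZero.nonZero (k !≢0) }
        swap : ∀ x y z → x * y * z ≡ x * z * y
        swap = solve-∀

signedBinom : ℤ → ℕ → ℤ
signedBinom a k = binomℤ (a - 1ℤ) k * sgn k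

signedBinom-suc : ∀ a k → signedBinom a (suc k) * + suc k ≡ signedBinom a k * (+ suc k - a)
signedBinom-suc a k = begin
  binomℤ (a - 1ℤ) (suc k) * ℤ.- sgn k * + suc k     ≡⟨ pull (binomℤ (a - 1ℤ) (suc k)) (sgn k) (+ suc k) ⟩
  ℤ.- sgn k * (binomℤ (a - 1ℤ) (suc k) * + suc k)   ≡⟨ cong (ℤ.- sgn k *_) (binomℤ-suc (a - 1ℤ) k) ⟩
  ℤ.- sgn k * (binomℤ (a - 1ℤ) k * (a - 1ℤ - + k))  ≡⟨ rearrange (binomℤ (a - 1ℤ) k) (sgn k) a (+ k) ⟩
  signedBinom a k * ((1ℤ + + k) - a)                ≡⟨ cong (λ z → signedBinom a k * (z - a)) (sym (ℤP.pos-+ 1 k)) ⟩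
  signedBinom a k * (+ suc k - a)                   ∎
  where open ≡-Reasoning
        pull : ∀ b s j → b * ℤ.- s * j ≡ ℤ.- s * (b * j)
        pull = solve-∀
        rearrange : ∀ b s a k → ℤ.- s * (b * (a - 1ℤ - k)) ≡ b * s * ((1ℤ + k) - a)
        rearrange = solve-∀

prime-power-cancel : ∀ {p d x} r → Prime p → p ∤ₙ d → p ^ r ∣ₙ d ℕ.* x → p ^ r ∣ₙ x
prime-power-cancel zero _ _ _ = ℕ∣.1∣ _
prime-power-cancel {p} {d} {x} (suc r) pp p∤d h
  with euclidsLemma d x pp (ℕ∣.∣-trans (ℕ∣.m∣m*n (p ^ r)) h)
... | inj₁ p∣d = ⊥-elim (p∤d p∣d)
... | inj₂ (ℕ∣.divides y refl) =
  subst (p ^ suc r ∣ₙ_) (ℕP.*-comm p y) (ℕ∣.*-monoʳ-∣ p (prime-power-cancel r pp p∤d p^r∣dy))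
  where
  instance
    p≢0 : ℕ.NonZero p
    p≢0 = prime⇒nonZero pp
  regroup : d ℕ.* (y ℕ.* p) ≡ p ℕ.* (d ℕ.* y)
  regroup = trans (sym (ℕP.*-assoc d y p)) (ℕP.*-comm (d ℕ.* y) p)
  p^r∣dy : p ^ r ∣ₙ d ℕ.* y
  p^r∣dy = ℕ∣.*-cancelˡ-∣ p (subst (p ^ suc r ∣ₙ_) regroup h)

cross-∣ : ∀ {q d e a b} → d * a ≡ e * b → q ∣ₛ e - d → q ∣ₛ d * (a - b)
cross-∣ {q} {d} {e} {a} {b} da≡eb q∣e-d = subst (q ∣ₛ_) (sym difference) (ℤ∣.∣m⇒∣m*n b q∣e-d)
  where
  difference : d * (a - b) ≡ (e - d) * b
  difference = begin
    d * (a - b)     ≡⟨ expand d a b ⟩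
    d * a - d * b   ≡⟨ cong (_- d * b) da≡eb ⟩
    e * b - d * b   ≡⟨ sym (factor e d b) ⟩
    (e - d) * b     ∎
    where
    open ≡-Reasoning
    expand : ∀ d a b → d * (a - b) ≡ d * a - d * b
    expand = solve-∀
    factor : ∀ e d b → (e - d) * b ≡ e * b - d * b
    factor = solve-∀

-- From here on p is a fixed positive natural number; primality is assumed
-- only where it is needed (p ∤ D).
module _ (p : ℕ) .{{_ : ℕ.NonZero p}} where

  suc-divMod : ∀ k → suc k ≡ suc (k % p) ℕ.+ (k / p) ℕ.* p
  suc-divMod k = cong suc (ℕD.m≡m%n+[m/n]*n k p)

  ∣suc⇒ : ∀ k → p ∣ₙ suc k → suc k ≡ suc (k / p) ℕ.* p
  ∣suc⇒ k p∣k+1 = trans (suc-divMod k) (cong (ℕ._+ (k / p) ℕ.* p) last-residue)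
    where
    p∣residue : p ∣ₙ suc (k % p)
    p∣residue = ℕ∣.∣m+n∣m⇒∣n (subst (p ∣ₙ_) (trans (suc-divMod k) (ℕP.+-comm (suc (k % p)) ((k / p) ℕ.* p))) p∣k+1)
                             (ℕ∣.n∣m*n (k / p))
    last-residue : suc (k % p) ≡ p
    last-residue = ℕP.≤-antisym (ℕD.m%n<n k p) (ℕ∣.∣⇒≤ p∣residue)

  ∤suc⇒ : ∀ k → p ∤ₙ suc k → suc k / p ≡ k / p
  ∤suc⇒ k p∤k+1 = begin
    suc k / p                                  ≡⟨ cong (_/ p) (suc-divMod k) ⟩
    (suc (k % p) ℕ.+ (k / p) ℕ.* p) / p        ≡⟨ ℕD.+-distrib-/-∣ʳ (suc (k % p)) (ℕ∣.n∣m*n (k / p)) ⟩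
    suc (k % p) / p ℕ.+ (k / p) ℕ.* p / p      ≡⟨ cong₂ ℕ._+_ (ℕD.m<n⇒m/n≡0 residue<p) (ℕD.m*n/n≡m (k / p) p) ⟩
    k / p                                      ∎
    where
    open ≡-Reasoning
    residue<p : suc (k % p) ℕ.< p
    residue<p with ℕP.m≤n⇒m<n∨m≡n (ℕD.m%n<n k p)
    ... | inj₁ lt   = lt
    ... | inj₂ last = ⊥-elim (p∤k+1 (ℕ∣.divides (suc (k / p))
                        (trans (suc-divMod k) (cong (ℕ._+ (k / p) ℕ.* p) last))))

  pFreeFactorial : ℕ → ℕ
  pFreeFactorial zero = 1
  pFreeFactorial (suc k) with p ∣ₙ? suc k
  ... | yes _ = pFreeFactorial k
  ... | no  _ = pFreeFactorial k ℕ.* suc k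

  pFreeShifted : ℤ → ℕ → ℤ
  pFreeShifted N zero = 1ℤ
  pFreeShifted N (suc k) with p ∣ₙ? suc k
  ... | yes _ = pFreeShifted N k
  ... | no  _ = pFreeShifted N k * (+ suc k - N)

  -- The factorisation D(k)·S(Mp,k) = E(Mp,k)·S(M,⌊k/p⌋): the factors of S(Mp,k)
  -- with p ∣ j reassemble into S(M,⌊k/p⌋), the others into E/D.
  factorisation : ∀ M k → + pFreeFactorial k * signedBinom (M * + p) k
                        ≡ pFreeShifted (M * + p) k * signedBinom M (k / p)
  factorisation M zero = sym (cong (λ i → 1ℤ * signedBinom M i) (ℕD.0/n≡0 p))
  factorisation M (suc k) with p ∣ₙ? suc k
  ... | no p∤k+1 = begin
    + (D ℕ.* suc k) * S N (suc k)       ≡⟨ cong (_* S N (suc k)) (ℤP.pos-* D (suc k)) ⟩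
    + D * + suc k * S N (suc k)         ≡⟨ ℤP.*-assoc (+ D) (+ suc k) (S N (suc k)) ⟩
    + D * (+ suc k * S N (suc k))       ≡⟨ cong (+ D *_) (trans (ℤP.*-comm (+ suc k) _) (signedBinom-suc N k)) ⟩
    + D * (S N k * (+ suc k - N))       ≡⟨ sym (ℤP.*-assoc (+ D) (S N k) _) ⟩
    + D * S N k * (+ suc k - N)         ≡⟨ cong (_* (+ suc k - N)) (factorisation M k) ⟩
    E * S M (k / p) * (+ suc k - N)     ≡⟨ swap E (S M (k / p)) (+ suc k - N) ⟩
    E * (+ suc k - N) * S M (k / p)     ≡⟨ cong (λ i → E * (+ suc k - N) * S M i) (sym (∤suc⇒ k p∤k+1)) ⟩
    E * (+ suc k - N) * S M (suc k / p) ∎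
    where
    open ≡-Reasoning
    S : ℤ → ℕ → ℤ
    S = signedBinom
    N : ℤ
    N = M * + p
    D : ℕ
    D = pFreeFactorial k
    E : ℤ
    E = pFreeShifted N k
    swap : ∀ x y z → x * y * z ≡ x * z * y
    swap = solve-∀
  ... | yes p∣k+1 = ℤP.*-cancelʳ-≡ _ _ (+ suc k) (begin
    + D * S N (suc k) * + suc k       ≡⟨ ℤP.*-assoc (+ D) _ _ ⟩
    + D * (S N (suc k) * + suc k)     ≡⟨ cong (+ D *_) (signedBinom-suc N k) ⟩
    + D * (S N k * (+ suc k - N))     ≡⟨ sym (ℤP.*-assoc (+ D) (S N k) _) ⟩
    + D * S N k * (+ suc k - N)       ≡⟨ cong (_* (+ suc k - N)) (factorisation M k) ⟩
    E * S M i * (+ suc k - N)         ≡⟨ cong (λ z → E * S M i * (z - N)) k+1≡[i+1]p ⟩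
    E * S M i * (+ suc i * + p - N)   ≡⟨ factor-p E (S M i) (+ suc i) (+ p) M ⟩
    E * (S M i * (+ suc i - M)) * + p ≡⟨ cong (λ z → E * z * + p) (sym (signedBinom-suc M i)) ⟩
    E * (S M (suc i) * + suc i) * + p ≡⟨ regroup E (S M (suc i)) (+ suc i) (+ p) ⟩
    E * S M (suc i) * (+ suc i * + p) ≡⟨ cong₂ (λ j z → E * S M j * z) (sym (/-suc)) (sym k+1≡[i+1]p) ⟩
    E * S M (suc k / p) * + suc k     ∎)
    where
    open ≡-Reasoning
    S : ℤ → ℕ → ℤ
    S = signedBinom
    N : ℤ
    N = M * + p
    D : ℕ
    D = pFreeFactorial k
    E : ℤ
    E = pFreeShifted N k
    i : ℕ
    i = k / p
    /-suc : suc k / p ≡ suc i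
    /-suc = trans (cong (_/ p) (∣suc⇒ k p∣k+1)) (ℕD.m*n/n≡m (suc i) p)
    k+1≡[i+1]p : + suc k ≡ + suc i * + p
    k+1≡[i+1]p = trans (cong +_ (∣suc⇒ k p∣k+1)) (ℤP.pos-* (suc i) p)
    factor-p : ∀ e s a q m → e * s * (a * q - m * q) ≡ e * (s * (a - m)) * q
    factor-p = solve-∀
    regroup : ∀ e s a q → e * (s * a) * q ≡ e * s * (a * q)
    regroup = solve-∀

  -- E(N,k) ≡ D(k) modulo any q dividing N, as E(N,k) is E(0,k) = D(k) with
  -- every factor shifted by N.
  pFreeShifted≡pFreeFactorial : ∀ {q N} → q ∣ₛ N → ∀ k → q ∣ₛ pFreeShifted N k - + pFreeFactorial k
  pFreeShifted≡pFreeFactorial q∣N zero = divides 0ℤ refl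
  pFreeShifted≡pFreeFactorial {q} {N} q∣N (suc k) with p ∣ₙ? suc k
  ... | yes _ = pFreeShifted≡pFreeFactorial q∣N k
  ... | no  _ = subst (q ∣ₛ_) (sym expand)
        (ℤ∣.∣m∣n⇒∣m-n (ℤ∣.∣m⇒∣m*n (+ suc k) (pFreeShifted≡pFreeFactorial q∣N k)) (ℤ∣.∣n⇒∣m*n E q∣N))
    where
    E : ℤ
    E = pFreeShifted N k
    D : ℕ
    D = pFreeFactorial k
    expand : E * (+ suc k - N) - + (D ℕ.* suc k) ≡ (E - + D) * + suc k - E * N
    expand = trans (cong (E * (+ suc k - N) -_) (ℤP.pos-* D (suc k))) (ring E (+ suc k) N (+ D))
      where ring : ∀ e s n d → e * (s - n) - d * s ≡ (e - d) * s - e * n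
            ring = solve-∀

  p∤pFreeFactorial : Prime p → ∀ k → p ∤ₙ pFreeFactorial k
  p∤pFreeFactorial pp zero p∣1 = ℕ.nonTrivial⇒≢1 {{prime⇒nonTrivial pp}} (ℕ∣.∣1⇒≡1 p∣1)
  p∤pFreeFactorial pp (suc k) p∣D with p ∣ₙ? suc k
  ... | yes _ = p∤pFreeFactorial pp k p∣D
  ... | no p∤k+1 with euclidsLemma (pFreeFactorial k) (suc k) pp p∣D
  ...   | inj₁ p∣Dk  = p∤pFreeFactorial pp k p∣Dk
  ...   | inj₂ p∣k+1 = p∤k+1 p∣k+1

lemma2p4 : (p : ℕ) → (pp : Prime p) → (m : ℤ) → (k r : ℕ) → 1 ≤ r →
    (+ (p ^ r)) ∣ ((binomℤ (m * + (p ^ r) - + 1) k * sgn k) - (binomℤ (m * + (p ^ (r ∸ 1)) - + 1) (_/_ k p {{prime⇒nonZero pp}}) * sgn (_/_ k p {{prime⇒nonZero pp}})))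
lemma2p4 p pp m k zero ()
lemma2p4 p pp m k (suc r) _ =
  prime-power-cancel (suc r) pp (p∤pFreeFactorial p pp k)
    (subst (p ^ suc r ∣ₙ_) (ℤP.abs-* (+ D) (A - B)) (ℤ∣.∣⇒∣ᵤ p^[r+1]∣D[A-B]))
  where
  instance
    p≢0 : ℕ.NonZero p
    p≢0 = prime⇒nonZero pp
  M N E A B : ℤ
  M = m * + (p ^ r)
  N = m * + (p ^ suc r)
  E = pFreeShifted p N k
  A = signedBinom N k
  B = signedBinom M (k / p)
  D : ℕ
  D = pFreeFactorial p k
  N≡Mp : N ≡ M * + p
  N≡Mp = begin
    m * + (p ℕ.* p ^ r)     ≡⟨ cong (m *_) (trans (cong +_ (ℕP.*-comm p (p ^ r))) (ℤP.pos-* (p ^ r) p)) ⟩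
    m * (+ (p ^ r) * + p)   ≡⟨ sym (ℤP.*-assoc m _ _) ⟩
    M * + p                 ∎
    where open ≡-Reasoning
  D·A≡E·B : + D * A ≡ E * B
  D·A≡E·B = subst (λ n → + D * signedBinom n k ≡ pFreeShifted p n k * B) (sym N≡Mp) (factorisation p M k)
  p^[r+1]∣D[A-B] : + (p ^ suc r) ∣ₛ + D * (A - B)
  p^[r+1]∣D[A-B] = cross-∣ {d = + D} {e = E} {a = A} {b = B} D·A≡E·B (pFreeShifted≡pFreeFactorial p (divides m refl) k)
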